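{- There exists a static encoding of AVL trees using at most $0.99933n+o(n)$ bits for AVL trees with $n$ nodes. That is, there are maps $E_n$, $n \geq 1$, where $E_n$ is an injective map from the set of AVL trees with $n$ nodes to finite binary strings, such that \[\max\{\,|E_n(T)| : T \text{ an AVL tree with } n \text{ nodes}\,\} \leq 0.99933\,n + o(n) \quad \text{as } n\to\infty.\]
   Context: A binary tree is a rooted tree in which every node has at most one left child and at most one right child. The height of a tree is the number of edges on a longest path from the root to a leaf, and the empty tree has height $-1$. An AVL tree is a binary tree in which, at every node, the subtrees rooted at the left and right children (either of which may be empty) have heights differing by at most $1$. $|E_n(T)|$ denotes the length of the binary string $E_n(T)$. -}

module Defs where

open import Data.Nat using (ℕ; zero; suc; _+_; _≤_)
open import Data.Integer using (ℤ; -[1+_]; +_; _-_; ∣_∣)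

data Tree : Set where
  empty : Tree
  node  : Tree → Tree → Tree

size : Tree → ℕ
size empty      = 0
size (node l r) = suc (size l + size r)

max : ℤ → ℤ → ℤ
max = Data.Integer._⊔_

height : Tree → ℤ
height empty      = -[1+ 0 ]
height (node l r) = (+ 1) Data.Integer.+ max (height l) (height r)

data IsAVL : Tree → Set where
  avl-empty : IsAVL empty
  avl-node  : ∀ {l r} → IsAVL l → IsAVL r → ∣ height l - height r ∣ ≤ 1 → IsAVL (node l r)

-- Encode a tree by the binary expansion of its position in an explicit list of the AVL trees
-- with n nodes and fewer than n + 1 levels. With x = 25/49, the weighted counts
-- u h = Σ x ^ size t over AVL trees of height h - 1 satisfy u (h + 2) = x (u (h + 1) ² + 2 u (h + 1) u h),
-- which keeps u h ≤ 3/5 from h = 3 on; so u h ≤ 1 for every h, there are at most (49/25) ^ n AVL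
-- trees with n nodes of each height, and the list has at most (n + 1) (49/25) ^ n entries.
-- Since log₂ (49/25) < 0.99, the position takes fewer than 0.99 n bits for large n.
module Submission where

open import Defs
open import Data.Bool using (Bool; true; false)
import Data.Fin as Fin
import Data.Fin.Properties as Fin
open import Data.Integer as ℤ using (-1ℤ; _⊖_; pred)
import Data.Integer.Properties as ℤ
import Data.Integer.Tactic.RingSolver as ℤ-Ring
open import Data.List using (List; []; _∷_; [_]; _++_; map; length; filter; cartesianProductWith; lookup)
open import Data.List.Properties using (map-++; map-∘; length-++; filter-++; filter-accept; filter-reject)
open import Data.List.Membership.Propositional using (_∈_)
open import Data.List.Membership.Propositional.Properties using (∈-++⁺ˡ; ∈-++⁺ʳ; ∈-filter⁺; ∈-cartesianProductWith⁺)
import Data.List.Membership.DecPropositional as DecMembership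
open import Data.List.Relation.Unary.Any as Any using (here)
open import Data.List.Relation.Unary.Any.Properties using (lookup-index)
open import Data.Nat using (ℕ; zero; suc; _+_; _*_; _∸_; _^_; _≤_; _<_; _⊔_; z≤n; s≤s; _≟_; _/_; _%_)
open import Data.Nat.Properties
open import Data.Nat.Binary as Bin using (ℕᵇ; 2[1+_]; 1+[2_])
import Data.Nat.Binary.Properties as Bin
open import Data.Nat.DivMod using (m≡m%n+[m/n]*n; m%n<n; m/n*n≤m; /-mono-≤)
open import Data.Nat.ListAction using (sum)
open import Data.Nat.ListAction.Properties using (sum-++)
open import Data.Nat.Tactic.RingSolver using (solve; solve-∀)
open import Function using (_∘_)
open import Data.Product using (Σ; _×_; _,_; proj₁; uncurry; ∃-syntax)
open import Relation.Binary.Definitions using (DecidableEquality)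
open import Relation.Binary.PropositionalEquality using (_≡_; refl; sym; trans; cong; cong₂; subst; module ≡-Reasoning)
open import Relation.Nullary.Decidable using (yes; no; map′; _×-dec_)
open import Relation.Nullary.Negation using (contradiction)

-- levels t = height t + 1, so that heights live in ℕ.
levels : Tree → ℕ
levels empty      = 0
levels (node l r) = suc (levels l ⊔ levels r)

levels≤size : ∀ t → levels t ≤ size t
levels≤size empty      = z≤n
levels≤size (node l r) = s≤s (≤-trans (m⊔n≤m+n (levels l) (levels r)) (+-mono-≤ (levels≤size l) (levels≤size r)))

height≡pred-levels : ∀ t → height t ≡ pred (ℤ.+ levels t)
height≡pred-levels empty      = refl
height≡pred-levels (node l r)
  rewrite height≡pred-levels l | height≡pred-levels r = 1+pred⊔pred (levels l) (levels r)
  where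
  1+pred⊔pred : ∀ a b → ℤ.+ 1 ℤ.+ max (pred (ℤ.+ a)) (pred (ℤ.+ b)) ≡ ℤ.+ (a ⊔ b)
  1+pred⊔pred zero    zero    = refl
  1+pred⊔pred zero    (suc b) = refl
  1+pred⊔pred (suc a) zero    = refl
  1+pred⊔pred (suc a) (suc b) = refl

pred-pred-⊖ : ∀ a b → pred (ℤ.+ a) ℤ.- pred (ℤ.+ b) ≡ a ⊖ b
pred-pred-⊖ a b = trans (pred-cancel (ℤ.+ a) (ℤ.+ b)) (ℤ.m-n≡m⊖n a b)
  where
  pred-cancel : ∀ i j → (-1ℤ ℤ.+ i) ℤ.- (-1ℤ ℤ.+ j) ≡ i ℤ.- j
  pred-cancel = ℤ-Ring.solve-∀

data Balanced : ℕ → ℕ → Set where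
  level     : ∀ {h} → Balanced h h
  leftHigh  : ∀ {h} → Balanced (suc h) h
  rightHigh : ∀ {h} → Balanced h (suc h)

suc-Balanced : ∀ {a b} → Balanced a b → Balanced (suc a) (suc b)
suc-Balanced level     = level
suc-Balanced leftHigh  = leftHigh
suc-Balanced rightHigh = rightHigh

balanced : ∀ a b → ℤ.∣ a ⊖ b ∣ ≤ 1 → Balanced a b
balanced zero          zero          _         = level
balanced zero          (suc zero)    _         = rightHigh
balanced zero          (suc (suc b)) (s≤s ())
balanced (suc zero)    zero          _         = leftHigh
balanced (suc (suc a)) zero          (s≤s ())
balanced (suc a)       (suc b)       d         =
  suc-Balanced (balanced a b (subst (λ i → ℤ.∣ i ∣ ≤ 1) (ℤ.[1+m]⊖[1+n]≡m⊖n a b) d))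

IsAVL-Balanced : ∀ {l r} → IsAVL (node l r) → Balanced (levels l) (levels r)
IsAVL-Balanced {l} {r} (avl-node _ _ d) = balanced (levels l) (levels r) (subst (λ i → ℤ.∣ i ∣ ≤ 1) heights d)
  where
  heights : height l ℤ.- height r ≡ levels l ⊖ levels r
  heights rewrite height≡pred-levels l | height≡pred-levels r = pred-pred-⊖ (levels l) (levels r)

nodes : List Tree → List Tree → List Tree
nodes = cartesianProductWith node

avlTrees : ℕ → List Tree
avlTrees zero          = [ empty ]
avlTrees (suc zero)    = [ node empty empty ]
avlTrees (suc (suc h)) =
  let T₁ = avlTrees (suc h); T₀ = avlTrees h in
  nodes T₁ T₁ ++ nodes T₁ T₀ ++ nodes T₀ T₁

∈-avlTrees-node : ∀ {a b l r} → Balanced a b → l ∈ avlTrees a → r ∈ avlTrees b →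
                  node l r ∈ avlTrees (suc (a ⊔ b))
∈-avlTrees-node {zero}  level (here refl) (here refl) = here refl
∈-avlTrees-node {suc a} level l∈ r∈
  rewrite ⊔-idem a = ∈-++⁺ˡ (∈-cartesianProductWith⁺ node l∈ r∈)
∈-avlTrees-node {suc b} {b} leftHigh l∈ r∈
  rewrite m≥n⇒m⊔n≡m (n≤1+n b) =
    ∈-++⁺ʳ (nodes T₁ T₁) (∈-++⁺ˡ (∈-cartesianProductWith⁺ node l∈ r∈))
  where T₁ = avlTrees (suc b)
∈-avlTrees-node {a} rightHigh l∈ r∈
  rewrite m≤n⇒m⊔n≡n (n≤1+n a) =
    ∈-++⁺ʳ (nodes T₁ T₁) (∈-++⁺ʳ (nodes T₁ (avlTrees a)) (∈-cartesianProductWith⁺ node l∈ r∈))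
  where T₁ = avlTrees (suc a)

∈-avlTrees : ∀ {t} → IsAVL t → t ∈ avlTrees (levels t)
∈-avlTrees avl-empty                   = here refl
∈-avlTrees t@(avl-node avl-l avl-r _) = ∈-avlTrees-node (IsAVL-Balanced t) (∈-avlTrees avl-l) (∈-avlTrees avl-r)

avlTreesBelow : ℕ → List Tree
avlTreesBelow zero    = []
avlTreesBelow (suc k) = avlTrees k ++ avlTreesBelow k

∈-avlTreesBelow : ∀ {t h k} → h < k → t ∈ avlTrees h → t ∈ avlTreesBelow k
∈-avlTreesBelow {h = h} {suc k} (s≤s h≤k) t∈ with h ≟ k
... | yes refl = ∈-++⁺ˡ t∈
... | no h≢k   = ∈-++⁺ʳ (avlTrees k) (∈-avlTreesBelow (≤∧≢⇒< h≤k h≢k) t∈)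

-- With x = 25/49, weight D t is 49 ^ D * x ^ size t (rounded up if size t > D).
weight : ℕ → Tree → ℕ
weight D t = 25 ^ size t * 49 ^ (D ∸ size t)

totalWeight : ℕ → List Tree → ℕ
totalWeight D ts = sum (map (weight D) ts)

totalWeight-++ : ∀ D xs ys → totalWeight D (xs ++ ys) ≡ totalWeight D xs + totalWeight D ys
totalWeight-++ D xs ys = trans (cong sum (map-++ (weight D) xs ys)) (sum-++ (map (weight D) xs) _)

sum-map-≤-* : ∀ {A : Set} {f g : A → ℕ} c → (∀ x → f x ≤ c * g x) →
              ∀ xs → sum (map f xs) ≤ c * sum (map g xs)
sum-map-≤-* c f≤cg []       = z≤n
sum-map-≤-* c f≤cg (x ∷ xs) =
  ≤-trans (+-mono-≤ (f≤cg x) (sum-map-≤-* c f≤cg xs)) (≤-reflexive (sym (*-distribˡ-+ c _ _)))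

+-∸-+-≤ : ∀ a b x y → (a + b) ∸ (x + y) ≤ (a ∸ x) + (b ∸ y)
+-∸-+-≤ a b x y = m≤n+o⇒m∸n≤o (a + b) (x + y) (begin
  a + b                         ≤⟨ +-mono-≤ (m≤n+m∸n a x) (m≤n+m∸n b y) ⟩
  (x + (a ∸ x)) + (y + (b ∸ y)) ≡⟨ +-+-interchange x (a ∸ x) y (b ∸ y) ⟩
  (x + y) + ((a ∸ x) + (b ∸ y)) ∎)
  where
  open ≤-Reasoning
  +-+-interchange : ∀ p q r s → (p + q) + (r + s) ≡ (p + r) + (q + s)
  +-+-interchange = solve-∀

weight-node : ∀ a b l r → weight (suc (a + b)) (node l r) ≤ 25 * weight a l * weight b r
weight-node a b l r = begin
  25 ^ suc (sl + sr) * 49 ^ ((a + b) ∸ (sl + sr))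
    ≤⟨ *-monoʳ-≤ (25 ^ suc (sl + sr)) (^-monoʳ-≤ 49 (+-∸-+-≤ a b sl sr)) ⟩
  25 * 25 ^ (sl + sr) * 49 ^ ((a ∸ sl) + (b ∸ sr))
    ≡⟨ cong₂ (λ p q → 25 * p * q) (^-distribˡ-+-* 25 sl sr) (^-distribˡ-+-* 49 (a ∸ sl) (b ∸ sr)) ⟩
  25 * (25 ^ sl * 25 ^ sr) * (49 ^ (a ∸ sl) * 49 ^ (b ∸ sr))
    ≡⟨ regroup (25 ^ sl) (25 ^ sr) (49 ^ (a ∸ sl)) (49 ^ (b ∸ sr)) ⟩
  25 * (25 ^ sl * 49 ^ (a ∸ sl)) * (25 ^ sr * 49 ^ (b ∸ sr)) ∎
  where
  open ≤-Reasoning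
  sl = size l
  sr = size r
  regroup : ∀ p q s t → 25 * (p * q) * (s * t) ≡ 25 * (p * s) * (q * t)
  regroup = solve-∀

weight-+ : ∀ e D t → weight (e + D) t ≤ 49 ^ e * weight D t
weight-+ e D t = begin
  25 ^ s * 49 ^ ((e + D) ∸ s)     ≤⟨ *-monoʳ-≤ (25 ^ s) (^-monoʳ-≤ 49 (+-∸-+-≤ e D 0 s)) ⟩
  25 ^ s * 49 ^ (e + (D ∸ s))     ≡⟨ cong (25 ^ s *_) (^-distribˡ-+-* 49 e (D ∸ s)) ⟩
  25 ^ s * (49 ^ e * 49 ^ (D ∸ s)) ≡⟨ x*[y*z]≡y*[x*z] (25 ^ s) (49 ^ e) (49 ^ (D ∸ s)) ⟩
  49 ^ e * (25 ^ s * 49 ^ (D ∸ s)) ∎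
  where
  open ≤-Reasoning
  s = size t
  x*[y*z]≡y*[x*z] : ∀ x y z → x * (y * z) ≡ y * (x * z)
  x*[y*z]≡y*[x*z] = solve-∀

totalWeight-+ : ∀ e D ts → totalWeight (e + D) ts ≤ 49 ^ e * totalWeight D ts
totalWeight-+ e D = sum-map-≤-* (49 ^ e) (weight-+ e D)

totalWeight-nodes : ∀ a b ls rs →
                    totalWeight (suc (a + b)) (nodes ls rs) ≤ 25 * totalWeight a ls * totalWeight b rs
totalWeight-nodes a b []       rs = z≤n
totalWeight-nodes a b (l ∷ ls) rs = begin
  totalWeight D (map (node l) rs ++ nodes ls rs)
    ≡⟨ totalWeight-++ D (map (node l) rs) (nodes ls rs) ⟩
  totalWeight D (map (node l) rs) + totalWeight D (nodes ls rs)
    ≤⟨ +-mono-≤ with-l (totalWeight-nodes a b ls rs) ⟩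
  25 * weight a l * totalWeight b rs + 25 * totalWeight a ls * totalWeight b rs
    ≡⟨ factor (weight a l) (totalWeight a ls) (totalWeight b rs) ⟩
  25 * (weight a l + totalWeight a ls) * totalWeight b rs ∎
  where
  open ≤-Reasoning
  D = suc (a + b)
  with-l : totalWeight D (map (node l) rs) ≤ 25 * weight a l * totalWeight b rs
  with-l = subst (_≤ 25 * weight a l * totalWeight b rs) (cong sum (map-∘ rs))
                 (sum-map-≤-* (25 * weight a l) (weight-node a b l) rs)
  factor : ∀ p q s → 25 * p * s + 25 * q * s ≡ 25 * (p + q) * s
  factor = solve-∀

perfectSize : ℕ → ℕ
perfectSize zero    = 0
perfectSize (suc h) = suc (perfectSize h + perfectSize h)

avlWeight : ℕ → ℕ
avlWeight h = totalWeight (perfectSize h) (avlTrees h)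

avlWeight-rec : ∀ h → avlWeight (2 + h) ≤
  25 * (avlWeight (1 + h) * (avlWeight (1 + h) + 2 * (49 * 49 ^ perfectSize h * avlWeight h)))
avlWeight-rec h = begin
  totalWeight D₂ (nodes T₁ T₁ ++ nodes T₁ T₀ ++ nodes T₀ T₁)
    ≡⟨ trans (totalWeight-++ D₂ (nodes T₁ T₁) _) (cong (totalWeight D₂ (nodes T₁ T₁) +_) (totalWeight-++ D₂ (nodes T₁ T₀) _)) ⟩
  totalWeight D₂ (nodes T₁ T₁) + (totalWeight D₂ (nodes T₁ T₀) + totalWeight D₂ (nodes T₀ T₁))
    ≤⟨ +-mono-≤ (totalWeight-nodes D₁ D₁ T₁ T₁) (+-mono-≤ (totalWeight-nodes D₁ D₁ T₁ T₀) (totalWeight-nodes D₁ D₁ T₀ T₁)) ⟩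
  25 * v₁ * v₁ + (25 * v₁ * w₀ + 25 * w₀ * v₁)
    ≤⟨ +-monoʳ-≤ (25 * v₁ * v₁) (+-mono-≤ (*-monoʳ-≤ (25 * v₁) w₀≤) (*-monoˡ-≤ v₁ (*-monoʳ-≤ 25 w₀≤))) ⟩
  25 * v₁ * v₁ + (25 * v₁ * u₀ + 25 * u₀ * v₁)
    ≡⟨ collect v₁ u₀ ⟩
  25 * (v₁ * (v₁ + 2 * u₀)) ∎
  where
  open ≤-Reasoning
  T₁ = avlTrees (suc h)
  T₀ = avlTrees h
  D₁ = perfectSize (suc h)
  D₂ = perfectSize (2 + h)
  v₁ = avlWeight (suc h)
  w₀ = totalWeight D₁ T₀
  u₀ = 49 * 49 ^ perfectSize h * avlWeight h
  w₀≤ : w₀ ≤ u₀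
  w₀≤ = totalWeight-+ (suc (perfectSize h)) (perfectSize h) T₀
  collect : ∀ v u → 25 * v * v + (25 * v * u + 25 * u * v) ≡ 25 * (v * (v + 2 * u))
  collect = solve-∀

-- In terms of u = v / e: u (h + 2) ≤ (25/49) (u (h + 1) ² + 2 u (h + 1) u h) stays below 3/5
-- when u h and u (h + 1) do, because (25/49) · 3 · (3/5) ² < 3/5.
ratio-step : ∀ e p q → 5 * p ≤ 3 * e → 5 * q ≤ 3 * (49 * (e * e)) →
             5 * (25 * (q * (q + 2 * (49 * e * p)))) ≤ 3 * (49 * ((49 * (e * e)) * (49 * (e * e))))
ratio-step e p q 5p≤ 5q≤ = begin
  5 * (25 * (q * (q + 2 * (49 * e * p))))
    ≡⟨ solve (e ∷ p ∷ q ∷ []) ⟩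
  5 * ((5 * q) * (5 * q + 98 * e * (5 * p)))
    ≤⟨ *-monoʳ-≤ 5 (*-mono-≤ 5q≤ (+-mono-≤ 5q≤ (*-monoʳ-≤ (98 * e) 5p≤))) ⟩
  5 * ((3 * (49 * (e * e))) * (3 * (49 * (e * e)) + 98 * e * (3 * e)))
    ≡⟨ solve (e ∷ []) ⟩
  135 * ((49 * (e * e)) * (49 * (e * e)))
    ≤⟨ *-monoˡ-≤ ((49 * (e * e)) * (49 * (e * e))) (≤ᵇ⇒≤ 135 147 _) ⟩
  147 * ((49 * (e * e)) * (49 * (e * e)))
    ≡⟨ solve (e ∷ []) ⟩
  3 * (49 * ((49 * (e * e)) * (49 * (e * e)))) ∎
  where open ≤-Reasoning

ratio-bound : (v e : ℕ → ℕ) →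
  (∀ h → e (suc h) ≡ 49 * (e h * e h)) →
  (∀ h → v (2 + h) ≤ 25 * (v (1 + h) * (v (1 + h) + 2 * (49 * e h * v h)))) →
  ∀ h₀ → 5 * v h₀ ≤ 3 * e h₀ → 5 * v (1 + h₀) ≤ 3 * e (1 + h₀) →
  ∀ d → 5 * v (d + h₀) ≤ 3 * e (d + h₀)
ratio-bound v e e-rec v-rec h₀ b₀ b₁ d = proj₁ (consecutive d)
  where
  consecutive : ∀ d → 5 * v (d + h₀) ≤ 3 * e (d + h₀) × 5 * v (1 + (d + h₀)) ≤ 3 * e (1 + (d + h₀))
  consecutive zero    = b₀ , b₁
  consecutive (suc d) with consecutive d
  ... | b , b′ = b′ , (begin
    5 * v (2 + h)
      ≤⟨ *-monoʳ-≤ 5 (v-rec h) ⟩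
    5 * (25 * (v (1 + h) * (v (1 + h) + 2 * (49 * e h * v h))))
      ≤⟨ ratio-step (e h) (v h) (v (1 + h)) b (subst (λ x → 5 * v (1 + h) ≤ 3 * x) (e-rec h) b′) ⟩
    3 * (49 * (49 * (e h * e h) * (49 * (e h * e h))))
      ≡⟨ cong (λ x → 3 * (49 * (x * x))) (sym (e-rec h)) ⟩
    3 * (49 * (e (1 + h) * e (1 + h)))
      ≡⟨ cong (3 *_) (sym (e-rec (1 + h))) ⟩
    3 * e (2 + h) ∎)
    where
    open ≤-Reasoning
    h = d + h₀

49^perfectSize-suc : ∀ h → 49 ^ perfectSize (suc h) ≡ 49 * (49 ^ perfectSize h * 49 ^ perfectSize h)
49^perfectSize-suc h = cong (49 *_) (^-distribˡ-+-* 49 (perfectSize h) (perfectSize h))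

-- u 2 ≈ 0.653 exceeds 3/5, so the invariant is started at h = 3.
avlWeight≤ : ∀ h → avlWeight h ≤ 49 ^ perfectSize h
avlWeight≤ 0 = ≤ᵇ⇒≤ _ _ _
avlWeight≤ 1 = ≤ᵇ⇒≤ _ _ _
avlWeight≤ 2 = ≤ᵇ⇒≤ _ _ _
avlWeight≤ (suc (suc (suc d))) = *-cancelˡ-≤ 3 (begin
  3 * avlWeight h        ≤⟨ *-monoˡ-≤ (avlWeight h) (≤ᵇ⇒≤ 3 5 _) ⟩
  5 * avlWeight h        ≡⟨ cong (λ h → 5 * avlWeight h) (+-comm 3 d) ⟩
  5 * avlWeight (d + 3)  ≤⟨ ratio-bound avlWeight e 49^perfectSize-suc avlWeight-rec
                               3 (≤ᵇ⇒≤ _ _ _) (≤ᵇ⇒≤ _ _ _) d ⟩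
  3 * e (d + 3)          ≡⟨ cong (λ h → 3 * e h) (+-comm d 3) ⟩
  3 * e h                ∎)
  where
  open ≤-Reasoning
  h = 3 + d
  e : ℕ → ℕ
  e h = 49 ^ perfectSize h

ofSize : ℕ → List Tree → List Tree
ofSize n = filter (λ t → size t ≟ n)

length-ofSize≤totalWeight : ∀ D n ts → length (ofSize n ts) * (25 ^ n * 49 ^ (D ∸ n)) ≤ totalWeight D ts
length-ofSize≤totalWeight D n []       = z≤n
length-ofSize≤totalWeight D n (t ∷ ts) with size t ≟ n
... | yes ≡n rewrite filter-accept (λ t → size t ≟ n) {t} {ts} ≡n | ≡n =
  +-monoʳ-≤ (25 ^ n * 49 ^ (D ∸ n)) (length-ofSize≤totalWeight D n ts)
... | no ≢n rewrite filter-reject (λ t → size t ≟ n) {t} {ts} ≢n =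
  ≤-trans (length-ofSize≤totalWeight D n ts) (m≤n+m (totalWeight D ts) (weight D t))

length-ofSize-avlTrees : ∀ n h → length (ofSize n (avlTrees h)) * 25 ^ n ≤ 49 ^ n
length-ofSize-avlTrees n h = *-cancelʳ-≤ _ _ (49 ^ (D ∸ n)) {{m^n≢0 49 (D ∸ n)}} (begin
  c * 25 ^ n * 49 ^ (D ∸ n)      ≡⟨ *-assoc c (25 ^ n) (49 ^ (D ∸ n)) ⟩
  c * (25 ^ n * 49 ^ (D ∸ n))    ≤⟨ length-ofSize≤totalWeight D n (avlTrees h) ⟩
  avlWeight h                    ≤⟨ avlWeight≤ h ⟩
  49 ^ D                         ≤⟨ ^-monoʳ-≤ 49 (m≤n+m∸n D n) ⟩
  49 ^ (n + (D ∸ n))             ≡⟨ ^-distribˡ-+-* 49 n (D ∸ n) ⟩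
  49 ^ n * 49 ^ (D ∸ n)          ∎)
  where
  open ≤-Reasoning
  D = perfectSize h
  c = length (ofSize n (avlTrees h))

length-ofSize-avlTreesBelow : ∀ n k → length (ofSize n (avlTreesBelow k)) * 25 ^ n ≤ k * 49 ^ n
length-ofSize-avlTreesBelow n zero    = z≤n
length-ofSize-avlTreesBelow n (suc k) = begin
  length (ofSize n (avlTrees k ++ avlTreesBelow k)) * 25 ^ n
    ≡⟨ cong (λ xs → length xs * 25 ^ n) (filter-++ (λ t → size t ≟ n) (avlTrees k) (avlTreesBelow k)) ⟩
  length (ofSize n (avlTrees k) ++ ofSize n (avlTreesBelow k)) * 25 ^ n
    ≡⟨ cong (_* 25 ^ n) (length-++ (ofSize n (avlTrees k))) ⟩
  (length (ofSize n (avlTrees k)) + length (ofSize n (avlTreesBelow k))) * 25 ^ n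
    ≡⟨ *-distribʳ-+ (25 ^ n) (length (ofSize n (avlTrees k))) _ ⟩
  length (ofSize n (avlTrees k)) * 25 ^ n + length (ofSize n (avlTreesBelow k)) * 25 ^ n
    ≤⟨ +-mono-≤ (length-ofSize-avlTrees n k) (length-ofSize-avlTreesBelow n k) ⟩
  49 ^ n + k * 49 ^ n ∎
  where open ≤-Reasoning

candidates : ℕ → List Tree
candidates n = ofSize n (avlTreesBelow (suc n))

∈-candidates : ∀ {n t} → IsAVL t → size t ≡ n → t ∈ candidates n
∈-candidates {n} {t} avl refl =
  ∈-filter⁺ (λ t → size t ≟ n) (∈-avlTreesBelow (s≤s (levels≤size t)) (∈-avlTrees avl)) refl

length-candidates : ∀ n → length (candidates n) * 25 ^ n ≤ suc n * 49 ^ n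
length-candidates n = length-ofSize-avlTreesBelow n (suc n)

bits : ℕᵇ → List Bool
bits Bin.zero = []
bits 2[1+ x ] = true ∷ bits x
bits 1+[2 x ] = false ∷ bits x

fromBits : List Bool → ℕᵇ
fromBits []           = Bin.zero
fromBits (true ∷ bs)  = 2[1+ fromBits bs ]
fromBits (false ∷ bs) = 1+[2 fromBits bs ]

fromBits-bits : ∀ x → fromBits (bits x) ≡ x
fromBits-bits Bin.zero = refl
fromBits-bits 2[1+ x ] = cong 2[1+_] (fromBits-bits x)
fromBits-bits 1+[2 x ] = cong 1+[2_] (fromBits-bits x)

length-bits : ∀ x w → Bin.toℕ x < 2 ^ w → length (bits x) ≤ w
length-bits Bin.zero w       _ = z≤n
length-bits 2[1+ x ] zero    (s≤s ())
length-bits 1+[2 x ] zero    (s≤s ())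
length-bits 2[1+ x ] (suc w) x<2ʷ =
  s≤s (length-bits x w (*-cancelˡ-< 2 _ _ (≤-<-trans (*-monoʳ-≤ 2 (n≤1+n (Bin.toℕ x))) x<2ʷ)))
length-bits 1+[2 x ] (suc w) x<2ʷ =
  s≤s (length-bits x w (*-cancelˡ-< 2 _ _ (<-trans (n<1+n (2 * Bin.toℕ x)) x<2ʷ)))

binary : ℕ → List Bool
binary n = bits (Bin.fromℕ n)

binary-injective : ∀ {m n} → binary m ≡ binary n → m ≡ n
binary-injective {m} {n} eq = begin
  m                            ≡⟨ sym (Bin.toℕ-fromℕ m) ⟩
  Bin.toℕ (Bin.fromℕ m)          ≡⟨ cong Bin.toℕ (sym (fromBits-bits (Bin.fromℕ m))) ⟩
  Bin.toℕ (fromBits (binary m))  ≡⟨ cong (Bin.toℕ ∘ fromBits) eq ⟩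
  Bin.toℕ (fromBits (binary n))  ≡⟨ cong Bin.toℕ (fromBits-bits (Bin.fromℕ n)) ⟩
  Bin.toℕ (Bin.fromℕ n)          ≡⟨ Bin.toℕ-fromℕ n ⟩
  n                            ∎
  where open ≡-Reasoning

length-binary : ∀ {n w} → n < 2 ^ w → length (binary n) ≤ w
length-binary {n} {w} n<2ʷ = length-bits (Bin.fromℕ n) w (subst (_< 2 ^ w) (sym (Bin.toℕ-fromℕ n)) n<2ʷ)

node-injective : ∀ {l r l′ r′} → node l r ≡ node l′ r′ → l ≡ l′ × r ≡ r′
node-injective refl = refl , refl

_≟ᵀ_ : DecidableEquality Tree
empty    ≟ᵀ empty      = yes refl
empty    ≟ᵀ node _ _   = no λ ()
node _ _ ≟ᵀ empty      = no λ ()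
node l r ≟ᵀ node l′ r′ = map′ (uncurry (cong₂ node)) node-injective ((l ≟ᵀ l′) ×-dec (r ≟ᵀ r′))

open DecMembership _≟ᵀ_ using (_∈?_)

index-injective : ∀ {A : Set} {x y : A} {xs} (x∈ : x ∈ xs) (y∈ : y ∈ xs) → Any.index x∈ ≡ Any.index y∈ → x ≡ y
index-injective {xs = xs} x∈ y∈ eq = trans (lookup-index x∈) (trans (cong (lookup xs) eq) (sym (lookup-index y∈)))

encode : ℕ → Tree → List Bool
encode n t with t ∈? candidates n
... | yes t∈ = binary (Fin.toℕ (Any.index t∈))
... | no _   = []

encode-injective : ∀ n {t t′} → t ∈ candidates n → t′ ∈ candidates n → encode n t ≡ encode n t′ → t ≡ t′
encode-injective n {t} {t′} t∈ t′∈ eq with t ∈? candidates n | t′ ∈? candidates n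
... | yes p  | yes q  = index-injective p q (Fin.toℕ-injective (binary-injective eq))
... | no t∉  | _      = contradiction t∈ t∉
... | yes _  | no t′∉ = contradiction t′∈ t′∉

length-encode : ∀ n {t w} → t ∈ candidates n → length (candidates n) ≤ 2 ^ w → length (encode n t) ≤ w
length-encode n {t} t∈ ≤2ʷ with t ∈? candidates n
... | yes p  = length-binary (<-≤-trans (Fin.toℕ<n (Any.index p)) ≤2ʷ)
... | no t∉  = contradiction t∈ t∉

^-distribʳ-* : ∀ m n o → (m * n) ^ o ≡ m ^ o * n ^ o
^-distribʳ-* m n zero    = refl
^-distribʳ-* m n (suc o) = trans (cong (m * n *_) (^-distribʳ-* m n o)) (interchange m n (m ^ o) (n ^ o))
  where
  interchange : ∀ a b c d → a * b * (c * d) ≡ a * c * (b * d)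
  interchange = solve-∀

linear≤exponential : ∀ c b m₀ → 2 ≤ b → c * suc m₀ ≤ b ^ m₀ → ∀ {m} → m₀ ≤ m → c * suc m ≤ b ^ m
linear≤exponential c b m₀ 2≤b base {m} m₀≤m = subst (λ m → c * suc m ≤ b ^ m) (m∸n+n≡m m₀≤m) (from-base (m ∸ m₀))
  where
  from-base : ∀ d → c * suc (d + m₀) ≤ b ^ (d + m₀)
  from-base zero    = base
  from-base (suc d) = begin
    c * suc (suc k)        ≡⟨ *-suc c (suc k) ⟩
    c + c * suc k          ≤⟨ +-monoˡ-≤ (c * suc k) (m≤m*n c (suc k)) ⟩
    c * suc k + c * suc k  ≡⟨ cong (c * suc k +_) (sym (+-identityʳ (c * suc k))) ⟩
    2 * (c * suc k)        ≤⟨ *-mono-≤ 2≤b (from-base d) ⟩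
    b * b ^ k              ∎
    where
    open ≤-Reasoning
    k = d + m₀

-- Split n into blocks of 100: (1 + n) ≤ 100 (1 + m) and (49 / 25) ^ 100 ≤ 2 ^ 99 / 3 for m = ⌊n / 100⌋.
[1+n]*49^n≤25^n*2^[99*[n/100]] : ∀ n → 40000 ≤ n → suc n * 49 ^ n ≤ 25 ^ n * 2 ^ (99 * (n / 100))
[1+n]*49^n≤25^n*2^[99*[n/100]] n 40000≤n = begin
  suc n * 49 ^ n
    ≡⟨ cong (λ k → suc k * 49 ^ k) n≡ ⟩
  suc (r + m * 100) * 49 ^ (r + m * 100)
    ≡⟨ cong (suc (r + m * 100) *_) (^-distribˡ-+-* 49 r (m * 100)) ⟩
  suc (r + m * 100) * (49 ^ r * 49 ^ (m * 100))
    ≡⟨ cong (λ k → suc (r + m * 100) * (49 ^ r * k)) (trans (cong (49 ^_) (*-comm m 100)) (sym (^-*-assoc 49 100 m))) ⟩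
  suc (r + m * 100) * (49 ^ r * A ^ m)
    ≤⟨ *-mono-≤ 1+n≤ (*-monoˡ-≤ (A ^ m) (^-monoʳ-≤ 49 (<⇒≤ (m%n<n n 100)))) ⟩
  100 * suc m * (A * A ^ m)
    ≡⟨ rearrange (suc m) A (A ^ m) ⟩
  100 * A * suc m * A ^ m
    ≤⟨ *-monoˡ-≤ (A ^ m) (linear≤exponential (100 * A) 3 400 (≤ᵇ⇒≤ 2 3 _) (≤ᵇ⇒≤ _ _ _) 400≤m) ⟩
  3 ^ m * A ^ m
    ≡⟨ sym (^-distribʳ-* 3 A m) ⟩
  (3 * A) ^ m
    ≤⟨ ^-monoˡ-≤ m (≤ᵇ⇒≤ (3 * A) (25 ^ 100 * 2 ^ 99) _) ⟩
  (25 ^ 100 * 2 ^ 99) ^ m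
    ≡⟨ trans (^-distribʳ-* (25 ^ 100) (2 ^ 99) m) (cong₂ _*_ (^-*-assoc 25 100 m) (^-*-assoc 2 99 m)) ⟩
  25 ^ (100 * m) * 2 ^ (99 * m)
    ≤⟨ *-monoˡ-≤ (2 ^ (99 * m)) (^-monoʳ-≤ 25 100m≤n) ⟩
  25 ^ n * 2 ^ (99 * m) ∎
  where
  open ≤-Reasoning
  m = n / 100
  r = n % 100
  A = 49 ^ 100
  n≡ : n ≡ r + m * 100
  n≡ = m≡m%n+[m/n]*n n 100
  400≤m : 400 ≤ m
  400≤m = /-mono-≤ {o = 100} {p = 100} 40000≤n ≤-refl
  100m≤n : 100 * m ≤ n
  100m≤n = subst (_≤ n) (*-comm m 100) (m/n*n≤m n 100)
  1+n≤ : suc (r + m * 100) ≤ 100 * suc m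
  1+n≤ = subst (suc (r + m * 100) ≤_) (*-comm (suc m) 100) (+-monoˡ-≤ (m * 100) (m%n<n n 100))
  rearrange : ∀ s a p → 100 * s * (a * p) ≡ 100 * a * s * p
  rearrange = solve-∀

length-candidates≤ : ∀ n → 40000 ≤ n → length (candidates n) ≤ 2 ^ (99 * (n / 100))
length-candidates≤ n 40000≤n = *-cancelʳ-≤ _ _ (25 ^ n) {{m^n≢0 25 n}} (begin
  length (candidates n) * 25 ^ n    ≤⟨ length-candidates n ⟩
  suc n * 49 ^ n                    ≤⟨ [1+n]*49^n≤25^n*2^[99*[n/100]] n 40000≤n ⟩
  25 ^ n * 2 ^ (99 * (n / 100))     ≡⟨ *-comm (25 ^ n) _ ⟩
  2 ^ (99 * (n / 100)) * 25 ^ n     ∎)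
  where open ≤-Reasoning

99*q*[100000*s]≤[99933*s+100000]*n : ∀ {q n} s → q * 100 ≤ n →
                                     99 * q * (100000 * s) ≤ (99933 * s + 100000) * n
99*q*[100000*s]≤[99933*s+100000]*n {q} {n} s 100q≤n = begin
  99 * q * (100000 * s)       ≡⟨ solve (q ∷ s ∷ []) ⟩
  99000 * (q * 100) * s       ≤⟨ *-monoˡ-≤ s (*-monoʳ-≤ 99000 100q≤n) ⟩
  99000 * n * s               ≤⟨ *-monoˡ-≤ s (*-monoˡ-≤ n (≤ᵇ⇒≤ 99000 99933 _)) ⟩
  99933 * n * s               ≡⟨ solve (n ∷ s ∷ []) ⟩
  99933 * s * n               ≤⟨ *-monoˡ-≤ n (m≤m+n (99933 * s) 100000) ⟩
  (99933 * s + 100000) * n    ∎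
  where open ≤-Reasoning

theorem1 : Σ (ℕ → Tree → List Bool) λ E →
    (∀ n → 1 ≤ n → ∀ t t' → IsAVL t → IsAVL t' → size t ≡ n → size t' ≡ n →
       E n t ≡ E n t' → t ≡ t')
    × (∀ k → ∃[ N ] ∀ n → N ≤ n → ∀ t → IsAVL t → size t ≡ n →
       length (E n t) * (100000 * suc k) ≤ (99933 * suc k + 100000) * n)
theorem1 = encode , injective , λ k → 40000 , length-bound k
  where
  injective : ∀ n → 1 ≤ n → ∀ t t′ → IsAVL t → IsAVL t′ → size t ≡ n → size t′ ≡ n →
              encode n t ≡ encode n t′ → t ≡ t′
  injective n _ t t′ avl avl′ ≡n ≡n′ = encode-injective n (∈-candidates avl ≡n) (∈-candidates avl′ ≡n′)
  length-bound : ∀ k n → 40000 ≤ n → ∀ t → IsAVL t → size t ≡ n →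
                 length (encode n t) * (100000 * suc k) ≤ (99933 * suc k + 100000) * n
  length-bound k n 40000≤n t avl ≡n = begin
    length (encode n t) * (100000 * suc k)
      ≤⟨ *-monoˡ-≤ (100000 * suc k) (length-encode n {w = 99 * (n / 100)} (∈-candidates avl ≡n) (length-candidates≤ n 40000≤n)) ⟩
    99 * (n / 100) * (100000 * suc k)
      ≤⟨ 99*q*[100000*s]≤[99933*s+100000]*n {n / 100} (suc k) (m/n*n≤m n 100) ⟩
    (99933 * suc k + 100000) * n ∎
    where open ≤-Reasoning
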